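{- Let $n\ge1$, let $\pi=\ddot\psi\backslash x_0\cdots x_n$ with $x_0,\dots,x_n\in\{\mathtt q,\mathtt s\}$, and let $k\in\{0,\dots,n-1\}$. With $\mathrm{pos}=aaddddadaaadad$, $\mathrm{neg}=daddddadaaadad$, $\mathrm{dk}=adadddadaaadad$: (i) $f_\pi(3\backslash k,\mathrm{pos})=2\backslash(k+1)$ if $x_k=\mathtt q$, and $f_\pi(3\backslash k,\mathrm{neg})=2\backslash(k+1)$ if $x_k=\mathtt s$; (ii) $f_\pi(3\backslash k,\mathrm{dk})=3\backslash(k+1)$, $f_\pi(3\backslash k,\mathrm{pos})=3\backslash(k+1)$ if $x_k\ne\mathtt q$, and $f_\pi(3\backslash k,\mathrm{neg})=3\backslash(k+1)$ if $x_k\ne\mathtt s$; (iii) $f_\pi(2\backslash k,W)=2\backslash(k+1)$ for each $W\in\{\mathrm{pos},\mathrm{neg},\mathrm{dk}\}$; (iv) $f_\pi(5\backslash k,W)\ge 5\backslash(k+1)$ for each $W\in\{\mathrm{pos},\mathrm{neg},\mathrm{dk}\}$.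
   Context: For $\psi\in\{\mathtt q,\mathtt s\}^N$ indexed from $0$, $\Pi(\psi)$ is the DFA over $\{a,d\}$ with states $\{0,\dots,N\}$, start $0$, accepting $\{0,\dots,N-1\}$, transition from $k<N$ on $c$ to $k+[\psi(k)=\mathtt q,c=d]+[\psi(k)=\mathtt s,c=a]$, state $N$ absorbing; $f_\pi(k,W)$ is the state reached from $k$ after reading $W$. Let $\ddot\psi=\mathtt{qqqqss}$; for $A=x_0\cdots x_{L-1}\in\{\mathtt q,\mathtt s\}^L$, $\ddot\psi\backslash A$ is the chain $\Pi(B_0\cdots B_{L-1})$ with $B_k=\mathtt{qqqqss}$ if $x_k=\mathtt q$, $B_k=\mathtt{qqssss}$ if $x_k=\mathtt s$. For $0\le b\le5$, $b\backslash k$ denotes the state $b+6k$. -}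

module Defs where

open import Data.Nat using (ℕ; zero; suc; _+_; _*_)
open import Data.List using (List; []; _∷_; concatMap; foldl)
open import Data.Vec using (Vec; toList)

data Letter : Set where
  a d : Letter

data Lab : Set where
  q s : Lab

bump : Lab → Letter → ℕ
bump q a = 0
bump q d = 1
bump s a = 1
bump s d = 0

-- transition of Π(ψ): from k < N = length ψ on c go to k + bump (ψ k) c;
-- from k ≥ N (in particular the absorbing state N) stay at k.
step : List Lab → ℕ → Letter → ℕ
step []      k       c = k
step (p ∷ ψ) zero    c = bump p c
step (p ∷ ψ) (suc k) c = suc (step ψ k c)

f : List Lab → ℕ → List Letter → ℕ
f ψ k W = foldl (step ψ) k W

block : Lab → List Lab
block q = q ∷ q ∷ q ∷ q ∷ s ∷ s ∷ []
block s = q ∷ q ∷ s ∷ s ∷ s ∷ s ∷ []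

ddpsi\\ : {L : ℕ} → Vec Lab L → List Lab
ddpsi\\ A = concatMap block (toList A)

_\\_ : ℕ → ℕ → ℕ
b \\ k = b + 6 * k

pos neg dk : List Letter
pos = a ∷ a ∷ d ∷ d ∷ d ∷ d ∷ a ∷ d ∷ a ∷ a ∷ a ∷ d ∷ a ∷ d ∷ []
neg = d ∷ a ∷ d ∷ d ∷ d ∷ d ∷ a ∷ d ∷ a ∷ a ∷ a ∷ d ∷ a ∷ d ∷ []
dk  = a ∷ d ∷ a ∷ d ∷ d ∷ d ∷ a ∷ d ∷ a ∷ a ∷ a ∷ d ∷ a ∷ d ∷ []

-- A transition of Π(ψ) only depends on the label of the current state, so
-- prepending a block of six labels shifts every run by exactly 6.  This moves
-- all claims from block k down to block 0 of a chain B₀ B₁ t with t arbitrary,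
-- where they are a finite computation: the runs from levels 2 and 3 stay inside
-- B₀ B₁, and the run from level 5 reaches state 11 before it can leave them,
-- after which states never decrease.
{-# OPTIONS --safe #-}
module Submission where

open import Defs
open import Data.Nat using (ℕ; suc; zero; _≤_; _+_; _*_; z≤n; s≤s)
open import Data.Nat.Properties using (≤-refl; ≤-trans; +-monoʳ-≤; +-comm; +-assoc; *-suc)
open import Data.Vec using (Vec; lookup; _∷_)
open import Data.Fin using (Fin; toℕ; inject₁; zero; suc)
open import Data.Product using (_×_; _,_)
open import Data.List using (List; []; _∷_; _++_; length; take; drop)
open import Data.List.Properties using (foldl-++; take++drop≡id)
open import Relation.Binary.PropositionalEquality
  using (_≡_; refl; sym; cong; subst; subst₂; module ≡-Reasoning)
open import Relation.Nullary using (¬_; contradiction)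

step-inflationary : ∀ ψ k c → k ≤ step ψ k c
step-inflationary []      k       c = ≤-refl
step-inflationary (_ ∷ ψ) zero    c = z≤n
step-inflationary (_ ∷ ψ) (suc k) c = s≤s (step-inflationary ψ k c)

f-inflationary : ∀ ψ k W → k ≤ f ψ k W
f-inflationary ψ k []      = ≤-refl
f-inflationary ψ k (c ∷ W) = ≤-trans (step-inflationary ψ k c) (f-inflationary ψ (step ψ k c) W)

f-prefix-≤ : ∀ ψ k U V → f ψ k U ≤ f ψ k (U ++ V)
f-prefix-≤ ψ k U V rewrite foldl-++ (step ψ) k U V = f-inflationary ψ (f ψ k U) V

f-take-≤ : ∀ ψ k n W → f ψ k (take n W) ≤ f ψ k W
f-take-≤ ψ k n W =
  subst (f ψ k (take n W) ≤_) (cong (f ψ k) (take++drop≡id n W)) (f-prefix-≤ ψ k (take n W) (drop n W))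

step-++ : ∀ pre ψ k c → step (pre ++ ψ) (length pre + k) c ≡ length pre + step ψ k c
step-++ []        ψ k c = refl
step-++ (_ ∷ pre) ψ k c = cong suc (step-++ pre ψ k c)

f-++ : ∀ pre ψ k W → f (pre ++ ψ) (length pre + k) W ≡ length pre + f ψ k W
f-++ pre ψ k []      = refl
f-++ pre ψ k (c ∷ W) rewrite step-++ pre ψ k c = f-++ pre ψ (step ψ k c) W

\\-suc : ∀ b i → b \\ suc i ≡ 6 + b \\ i
\\-suc b i = begin
  b + 6 * suc i      ≡⟨ cong (b +_) (*-suc 6 i) ⟩
  b + (6 + 6 * i)    ≡⟨ sym (+-assoc b 6 (6 * i)) ⟩
  b + 6 + 6 * i      ≡⟨ cong (_+ 6 * i) (+-comm b 6) ⟩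
  6 + b + 6 * i      ≡⟨ +-assoc 6 b (6 * i) ⟩
  6 + (b + 6 * i)    ∎
  where open ≡-Reasoning

f-block-++ : ∀ x ψ b i W → f (block x ++ ψ) (b \\ suc i) W ≡ 6 + f ψ (b \\ i) W
f-block-++ x ψ b i W rewrite \\-suc b i = shift x
  where
  shift : ∀ y → f (block y ++ ψ) (6 + b \\ i) W ≡ 6 + f ψ (b \\ i) W
  shift q = f-++ (block q) ψ (b \\ i) W
  shift s = f-++ (block s) ψ (b \\ i) W

Reaches : List Lab → ℕ → ℕ → List Letter → ℕ → Set
Reaches π i b W c = f π (b \\ i) W ≡ c \\ suc i

Passes : List Lab → ℕ → ℕ → List Letter → ℕ → Set
Passes π i b W c = c \\ suc i ≤ f π (b \\ i) W

reaches-block-++ : ∀ x π i b W c → Reaches π i b W c → Reaches (block x ++ π) (suc i) b W c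
reaches-block-++ x π i b W c reach = begin
  f (block x ++ π) (b \\ suc i) W  ≡⟨ f-block-++ x π b i W ⟩
  6 + f π (b \\ i) W               ≡⟨ cong (6 +_) reach ⟩
  6 + c \\ suc i                   ≡⟨ sym (\\-suc c (suc i)) ⟩
  c \\ suc (suc i)                 ∎
  where open ≡-Reasoning

passes-block-++ : ∀ x π i b W c → Passes π i b W c → Passes (block x ++ π) (suc i) b W c
passes-block-++ x π i b W c pass =
  subst₂ _≤_ (sym (\\-suc c (suc i))) (sym (f-block-++ x π b i W)) (+-monoʳ-≤ 6 pass)

ThreeToTwo : List Lab → Lab → ℕ → Set
ThreeToTwo π x i = (x ≡ q → Reaches π i 3 pos 2) × (x ≡ s → Reaches π i 3 neg 2)

ThreeToThree : List Lab → Lab → ℕ → Set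
ThreeToThree π x i =
  Reaches π i 3 dk 3 × (¬ x ≡ q → Reaches π i 3 pos 3) × (¬ x ≡ s → Reaches π i 3 neg 3)

TwoToTwo : List Lab → ℕ → Set
TwoToTwo π i = Reaches π i 2 pos 2 × Reaches π i 2 neg 2 × Reaches π i 2 dk 2

FivePastFive : List Lab → ℕ → Set
FivePastFive π i = Passes π i 5 pos 5 × Passes π i 5 neg 5 × Passes π i 5 dk 5

BlockTransitions : List Lab → Lab → ℕ → Set
BlockTransitions π x i = ThreeToTwo π x i × ThreeToThree π x i × TwoToTwo π i × FivePastFive π i

blockTransitions-block-++ : ∀ y {π x i} → BlockTransitions π x i → BlockTransitions (block y ++ π) x (suc i)
blockTransitions-block-++ y {π} {i = i} ((p₁ , p₂) , (t₁ , t₂ , t₃) , (w₁ , w₂ , w₃) , (v₁ , v₂ , v₃)) =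
  ((λ x≡q → reach 3 pos 2 (p₁ x≡q)) , (λ x≡s → reach 3 neg 2 (p₂ x≡s))) ,
  (reach 3 dk 3 t₁ , (λ x≢q → reach 3 pos 3 (t₂ x≢q)) , (λ x≢s → reach 3 neg 3 (t₃ x≢s))) ,
  (reach 2 pos 2 w₁ , reach 2 neg 2 w₂ , reach 2 dk 2 w₃) ,
  (pass pos v₁ , pass neg v₂ , pass dk v₃)
  where
  reach : ∀ b W c → Reaches π i b W c → Reaches (block y ++ π) (suc i) b W c
  reach b W c = reaches-block-++ y π i b W c
  pass : ∀ W → Passes π i 5 W 5 → Passes (block y ++ π) (suc i) 5 W 5
  pass W = passes-block-++ y π i 5 W 5

threeToTwo-two-blocks : ∀ x y t → ThreeToTwo (block x ++ block y ++ t) x 0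
threeToTwo-two-blocks q q t = (λ _ → refl) , λ ()
threeToTwo-two-blocks q s t = (λ _ → refl) , λ ()
threeToTwo-two-blocks s q t = (λ ()) , λ _ → refl
threeToTwo-two-blocks s s t = (λ ()) , λ _ → refl

threeToThree-two-blocks : ∀ x y t → ThreeToThree (block x ++ block y ++ t) x 0
threeToThree-two-blocks q q t = refl , contradiction refl , λ _ → refl
threeToThree-two-blocks q s t = refl , contradiction refl , λ _ → refl
threeToThree-two-blocks s q t = refl , (λ _ → refl) , contradiction refl
threeToThree-two-blocks s s t = refl , (λ _ → refl) , contradiction refl

twoToTwo-two-blocks : ∀ x y t → TwoToTwo (block x ++ block y ++ t) 0
twoToTwo-two-blocks q q t = refl , refl , refl
twoToTwo-two-blocks q s t = refl , refl , refl
twoToTwo-two-blocks s q t = refl , refl , refl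
twoToTwo-two-blocks s s t = refl , refl , refl

-- The run from level 5 is at state 11 after 7 letters if B₁ = block q, after 10 if B₁ = block s.
fivePastFive-two-blocks : ∀ x y t → FivePastFive (block x ++ block y ++ t) 0
fivePastFive-two-blocks x@q y@q t = past 7 pos , past 7 neg , past 7 dk
  where past = f-take-≤ (block x ++ block y ++ t) 5
fivePastFive-two-blocks x@q y@s t = past 10 pos , past 10 neg , past 10 dk
  where past = f-take-≤ (block x ++ block y ++ t) 5
fivePastFive-two-blocks x@s y@q t = past 7 pos , past 7 neg , past 7 dk
  where past = f-take-≤ (block x ++ block y ++ t) 5
fivePastFive-two-blocks x@s y@s t = past 10 pos , past 10 neg , past 10 dk
  where past = f-take-≤ (block x ++ block y ++ t) 5

blockTransitions-two-blocks : ∀ x y t → BlockTransitions (block x ++ block y ++ t) x 0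
blockTransitions-two-blocks x y t =
  threeToTwo-two-blocks x y t , threeToThree-two-blocks x y t ,
  twoToTwo-two-blocks x y t , fivePastFive-two-blocks x y t

blockTransitions : ∀ {n} (x : Vec Lab (suc n)) (k : Fin n) →
  BlockTransitions (ddpsi\\ x) (lookup x (inject₁ k)) (toℕ k)
blockTransitions (x₀ ∷ x₁ ∷ xs) zero    = blockTransitions-two-blocks x₀ x₁ _
blockTransitions (x₀ ∷ xs)      (suc k) = blockTransitions-block-++ x₀ (blockTransitions xs k)

lemma9 : (n : ℕ) → 1 ≤ n → (x : Vec Lab (suc n)) → (k : Fin n) →
    let π = ddpsi\\ x
        xk = lookup x (inject₁ k)
        i = toℕ k
    in ((xk ≡ q → f π (3 \\ i) pos ≡ 2 \\ suc i)
        × (xk ≡ s → f π (3 \\ i) neg ≡ 2 \\ suc i))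
     × ((f π (3 \\ i) dk ≡ 3 \\ suc i)
        × (¬ (xk ≡ q) → f π (3 \\ i) pos ≡ 3 \\ suc i)
        × (¬ (xk ≡ s) → f π (3 \\ i) neg ≡ 3 \\ suc i))
     × ((f π (2 \\ i) pos ≡ 2 \\ suc i)
        × (f π (2 \\ i) neg ≡ 2 \\ suc i)
        × (f π (2 \\ i) dk ≡ 2 \\ suc i))
     × ((5 \\ suc i ≤ f π (5 \\ i) pos)
        × (5 \\ suc i ≤ f π (5 \\ i) neg)
        × (5 \\ suc i ≤ f π (5 \\ i) dk))
-- 1 ≤ n is implied by the existence of k : Fin n.
lemma9 _ _ = blockTransitions
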